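{- A finite simple graph $G$ is strong vertex $\mathfrak{I}$-contractible if and only if $G$ is $k$-dismantlable for some integer $k\ge 0$.
   Context: All graphs are finite and simple; $K(1)$ is the one-vertex graph; $N_G(v)$ is the subgraph induced on the neighbours of $v$, and $G-v$ is the graph obtained by deleting $v$. "Subgraph" means induced subgraph. The class $\mathfrak{I}_{SV}$ of strong vertex $\mathfrak{I}$-contractible graphs is the smallest class of graphs containing $K(1)$ such that: if $G\in\mathfrak{I}_{SV}$ and $G'$ is a subgraph of $G$ with $G'\in\mathfrak{I}_{SV}$, then the graph obtained from $G$ by adding a new vertex adjacent exactly to the vertices of $G'$ is in $\mathfrak{I}_{SV}$ (the empty graph is not in $\mathfrak{I}_{SV}$). A graph $H$ is a cone if some vertex of $H$ is adjacent to all other vertices of $H$. A vertex $v$ of $G$ is $0$-dismantlable if $N_G(v)$ is a cone; $G$ is $0$-dismantlable if it can be reduced to a single vertex by successively deleting $0$-dismantlable vertices. Inductively, for $k\ge1$, a vertex $v$ is $k$-dismantlable if $N_G(v)$ is a $(k-1)$-dismantlable graph, and $G$ is $k$-dismantlable if it can be reduced to a single vertex by successively deleting $k$-dismantlable vertices (of the current graph). -}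

module Defs where

open import Data.Nat using (ℕ; zero; suc)
open import Data.Fin using (Fin; zero; suc)
open import Data.Fin.Subset using (Subset; _∈_; _∉_; _∩_; ⁅_⁆; ∁; ⊤)
open import Data.Bool using (Bool; true; false)
open import Data.Vec using (tabulate)
open import Data.Product using (Σ; ∃; _×_; _,_)
open import Function.Bundles using (_↔_; Inverse)
open import Function.Definitions using (Injective)
open import Relation.Binary.PropositionalEquality using (_≡_; _≢_; refl)
open import Relation.Nullary using (¬_)

record Graph : Set where
  field
    n      : ℕ
    adj    : Fin n → Fin n → Bool
    adj-sym : ∀ i j → adj i j ≡ adj j i
    irrefl : ∀ i → adj i i ≡ false
open Graph public

record _≅_ (G H : Graph) : Set where
  field
    bij : Fin (n G) ↔ Fin (n H)
    pres : ∀ i j → adj H (Inverse.to bij i) (Inverse.to bij j) ≡ adj G i j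

K1 : Graph
K1 = record { n = 1 ; adj = λ _ _ → false ; adj-sym = λ _ _ → refl ; irrefl = λ _ → refl }

-- G' is (isomorphic to) an induced subgraph of G, witnessed by an
-- adjacency-preserving-and-reflecting injection of vertices.
record InducedEmbedding (G' G : Graph) : Set where
  field
    emb    : Fin (n G') → Fin (n G)
    inj    : Injective _≡_ _≡_ emb
    adjEmb : ∀ i j → adj G (emb i) (emb j) ≡ adj G' i j

-- Add a new vertex (vertex zero) adjacent exactly to the vertices u
-- with nb u ≡ true; old vertex i becomes suc i.
addVertex : (G : Graph) → (Fin (n G) → Bool) → Graph
addVertex G nb = record { n = suc (n G) ; adj = a ; adj-sym = s ; irrefl = ir }
  where
  a : Fin (suc (n G)) → Fin (suc (n G)) → Bool
  a zero zero = false
  a zero (suc j) = nb j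
  a (suc i) zero = nb i
  a (suc i) (suc j) = adj G i j
  s : ∀ i j → a i j ≡ a j i
  s zero zero = refl
  s zero (suc j) = refl
  s (suc i) zero = refl
  s (suc i) (suc j) = adj-sym G i j
  ir : ∀ i → a i i ≡ false
  ir zero = refl
  ir (suc i) = irrefl G i

-- The class 𝔍_SV of strong vertex 𝔍-contractible graphs: the smallest
-- isomorphism-closed class containing K(1) and closed under adding a
-- vertex adjacent exactly to the vertex set of an induced subgraph G'
-- of G with G' ∈ 𝔍_SV.

data ISV : Graph → Set where
  base   : ISV K1
  iso    : ∀ {G H} → ISV G → G ≅ H → ISV H
  extend : ∀ {G G'} → ISV G → ISV G' → (e : InducedEmbedding G' G)
         → (nb : Fin (n G) → Bool)
         → (∀ u → nb u ≡ true → ∃ λ i → InducedEmbedding.emb e i ≡ u)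
         → (∀ i → nb (InducedEmbedding.emb e i) ≡ true)
         → ISV (addVertex G nb)

-- Dismantlability.  Induced subgraphs of a fixed graph G are described
-- by their vertex subsets S : Subset (n G).

module _ (G : Graph) where

  private
    N = n G

  nbhd : Fin N → Subset N
  nbhd v = tabulate (adj G v)

  delete : Subset N → Fin N → Subset N
  delete S v = S ∩ ∁ ⁅ v ⁆

  IsCone : Subset N → Set
  IsCone S = ∃ λ c → c ∈ S × (∀ u → u ∈ S → u ≢ c → adj G c u ≡ true)

  data Reducible (P : Subset N → Fin N → Set) : Subset N → Set where
    single : ∀ x → Reducible P ⁅ x ⁆
    step   : ∀ {S} v → v ∈ S → P S v → Reducible P (delete S v) → Reducible P S

  mutual
    VertexDism : ℕ → Subset N → Fin N → Set
    VertexDism zero    S v = IsCone (S ∩ nbhd v)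
    VertexDism (suc k) S v = Dism k (S ∩ nbhd v)

    Dism : ℕ → Subset N → Set
    Dism k S = Reducible (VertexDism k) S

Dismantlable : ℕ → Graph → Set
Dismantlable k G = Dism G k ⊤

{-# OPTIONS --safe #-}

-- Inside a fixed graph G, both notions are governed by one recursive
-- predicate on vertex sets: S is collapsible if it is a singleton, or if
-- some v ∈ S leaves S − v and S ∩ N(v) collapsible.  A graph in 𝔍_SV
-- embedded in G has a collapsible image (split off the last added vertex,
-- whose neighbourhood is the attached subgraph), and conversely a
-- collapsible S is the image of a graph in 𝔍_SV built by the same
-- recursion.  A k-dismantlable S is collapsible because cones are (delete
-- non-apex vertices; the apex survives in both pieces).  Conversely a
-- collapsible S is k-dismantlable for k the nesting depth of the
-- recursion, since k-dismantlability implies (k+1)-dismantlability.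

module Submission where

open import Defs
open import Data.Bool using (Bool; true)
open import Data.Empty using (⊥-elim)
open import Data.Fin using (Fin; zero; suc; _≟_)
open import Data.Fin.Properties using (any?; 0≢1+n; suc-injective)
open import Data.Fin.Subset using (Subset; _∈_; _∩_; ⁅_⁆; ∁; ⊤; _⊆_; _⊂_)
open import Data.Fin.Subset.Induction using (Acc; acc; ⊂-wellFounded)
open import Data.Fin.Subset.Properties
  using (_∈?_; ⊆-antisym; x∈⁅x⁆; x∈⁅y⁆⇒x≡y; x∈⁅y⁆⇔x≡y; x∈p∩q⁺; x∈p∩q⁻; x∈∁p⇒x∉p; x∉p⇒x∈∁p; ∈⊤)
open import Data.Nat using (ℕ; zero; suc; _≤_; _≤′_; ≤′-refl; ≤′-step; _⊔_)
open import Data.Nat.Properties using (≤⇒≤′; m≤m⊔n; m≤n⊔m; m≤n⇒m≤1+n)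
open import Data.Product using (∃; Σ; _×_; _,_; proj₁; proj₂)
open import Data.Vec using (tabulate)
open import Data.Vec.Properties using ([]=⇒lookup; lookup⇒[]=; lookup∘tabulate)
open import Function using (_∘_; id)
open import Function.Bundles using (_⇔_; mk⇔; Equivalence; Inverse; mk↔ₛ′)
open import Function.Definitions using (Injective; StrictlySurjective)
open import Relation.Binary.PropositionalEquality
  using (_≡_; _≢_; refl; sym; trans; cong; cong₂; subst)
open import Relation.Nullary using (yes; no)
open import Relation.Nullary.Decidable using (¬?; _×-dec_; decidable-stable)

open InducedEmbedding

private
  variable
    l m N : ℕ
    A B C H : Graph

∈-tabulate⁻ : (f : Fin N → Bool) {u : Fin N} → u ∈ tabulate f → f u ≡ true
∈-tabulate⁻ f {u} p = trans (sym (lookup∘tabulate f u)) ([]=⇒lookup p)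

∈-tabulate⁺ : (f : Fin N → Bool) {u : Fin N} → f u ≡ true → u ∈ tabulate f
∈-tabulate⁺ f {u} p = lookup⇒[]= u (tabulate f) (trans (lookup∘tabulate f u) p)

record IsImageOf (S : Subset N) (f : Fin m → Fin N) : Set where
  field
    image⊆ : ∀ i → f i ∈ S
    ⊆image : ∀ {u} → u ∈ S → ∃ λ i → f i ≡ u
open IsImageOf

IsImageOf-∘ : ∀ {S : Subset N} {f : Fin m → Fin N} {g : Fin l → Fin m} →
              IsImageOf S f → StrictlySurjective _≡_ g → IsImageOf S (f ∘ g)
IsImageOf-∘ img g-onto .image⊆ i = image⊆ img _
IsImageOf-∘ img g-onto .⊆image u∈S with ⊆image img u∈S
... | i , refl with g-onto i
...   | j , refl = j , refl

IsImageOf-⊤-id : IsImageOf ⊤ (id {A = Fin N})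
IsImageOf-⊤-id = record { image⊆ = λ _ → ∈⊤ ; ⊆image = λ {u} _ → u , refl }

IsImageOf-singleton : ∀ {S : Subset N} {f : Fin 1 → Fin N} → IsImageOf S f → S ≡ ⁅ f zero ⁆
IsImageOf-singleton {S = S} {f} img = ⊆-antisym S⊆ (λ p → subst (_∈ S) (sym (x∈⁅y⁆⇒x≡y _ p)) (image⊆ img zero))
  where
  S⊆ : S ⊆ ⁅ f zero ⁆
  S⊆ u∈S with ⊆image img u∈S
  ... | zero , refl = x∈⁅x⁆ _

infixr 9 _∘ᴱ_

_∘ᴱ_ : InducedEmbedding B C → InducedEmbedding A B → InducedEmbedding A C
g ∘ᴱ f = record
  { emb    = emb g ∘ emb f
  ; inj    = inj f ∘ inj g
  ; adjEmb = λ i j → trans (adjEmb g (emb f i) (emb f j)) (adjEmb f i j)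
  }

suc-embedding : (nb : Fin (n H) → Bool) → InducedEmbedding H (addVertex H nb)
suc-embedding nb = record { emb = suc ; inj = suc-injective ; adjEmb = λ _ _ → refl }

≅⇒embedding : A ≅ B → InducedEmbedding A B
≅⇒embedding A≅B = record
  { emb    = to
  ; inj    = λ {x} {y} eq → trans (sym (strictlyInverseʳ x)) (trans (cong from eq) (strictlyInverseʳ y))
  ; adjEmb = _≅_.pres A≅B
  }
  where open Inverse (_≅_.bij A≅B)

id-embedding : InducedEmbedding A A
id-embedding = record { emb = id ; inj = id ; adjEmb = λ _ _ → refl }

onto-embedding⇒≅ : (e : InducedEmbedding A B) → IsImageOf ⊤ (emb e) → A ≅ B
onto-embedding⇒≅ {A = A} {B = B} e img = record
  { bij  = mk↔ₛ′ (emb e) back emb∘back (λ i → inj e (emb∘back (emb e i)))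
  ; pres = adjEmb e
  }
  where
  back : Fin (n B) → Fin (n A)
  back u = proj₁ (⊆image img (∈⊤ {x = u}))
  emb∘back : ∀ u → emb e (back u) ≡ u
  emb∘back u = proj₂ (⊆image img (∈⊤ {x = u}))

factor-embedding : ∀ {A B C} (e₁ : InducedEmbedding A C) (e₂ : InducedEmbedding B C) →
                   (∀ i → ∃ λ j → emb e₁ j ≡ emb e₂ i) →
                   Σ (InducedEmbedding B A) λ f → ∀ i → emb e₁ (emb f i) ≡ emb e₂ i
factor-embedding {A} {B} {C} e₁ e₂ lift = f , commutes
  where
  commutes : ∀ i → emb e₁ (proj₁ (lift i)) ≡ emb e₂ i
  commutes i = proj₂ (lift i)
  f : InducedEmbedding B A
  f = record
    { emb    = proj₁ ∘ lift
    ; inj    = λ {i} {j} eq → inj e₂ (trans (sym (commutes i)) (trans (cong (emb e₁) eq) (commutes j)))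
    ; adjEmb = λ i j → trans (sym (adjEmb e₁ _ _)) (trans (cong₂ (adj C) (commutes i) (commutes j)) (adjEmb e₂ i j))
    }

module _ (G : Graph) where

  private
    variable
      S T : Subset (n G)
      u v c : Fin (n G)

  adj⇒≢ : adj G v u ≡ true → u ≢ v
  adj⇒≢ {v} p refl with trans (sym p) (irrefl G v)
  ... | ()

  ∈-nbhd⁻ : u ∈ S ∩ nbhd G v → u ∈ S × adj G v u ≡ true
  ∈-nbhd⁻ {S = S} {v} p with x∈p∩q⁻ S (nbhd G v) p
  ... | u∈S , u∈N = u∈S , ∈-tabulate⁻ (adj G v) u∈N

  ∈-nbhd⁺ : u ∈ S → adj G v u ≡ true → u ∈ S ∩ nbhd G v
  ∈-nbhd⁺ {v = v} u∈S vu = x∈p∩q⁺ (u∈S , ∈-tabulate⁺ (adj G v) vu)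

  ∈-delete⁻ : u ∈ delete G S v → u ∈ S × u ≢ v
  ∈-delete⁻ {S = S} {v} p with x∈p∩q⁻ S (∁ ⁅ v ⁆) p
  ... | u∈S , u∉v = u∈S , λ u≡v → x∈∁p⇒x∉p u∉v (Equivalence.from x∈⁅y⁆⇔x≡y u≡v)

  ∈-delete⁺ : u ∈ S → u ≢ v → u ∈ delete G S v
  ∈-delete⁺ {v = v} u∈S u≢v = x∈p∩q⁺ (u∈S , x∉p⇒x∈∁p (u≢v ∘ x∈⁅y⁆⇒x≡y v))

  delete-⊂ : v ∈ S → delete G S v ⊂ S
  delete-⊂ {v} v∈S = proj₁ ∘ ∈-delete⁻ , v , v∈S , λ p → proj₂ (∈-delete⁻ p) refl

  nbhd-⊂ : v ∈ S → S ∩ nbhd G v ⊂ S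
  nbhd-⊂ {v} v∈S = proj₁ ∘ ∈-nbhd⁻ , v , v∈S , λ p → adj⇒≢ (proj₂ (∈-nbhd⁻ p)) refl

  data Collapsible : Subset (n G) → Set where
    point : ∀ x → Collapsible ⁅ x ⁆
    split : ∀ {S} v → v ∈ S → Collapsible (delete G S v) → Collapsible (S ∩ nbhd G v) → Collapsible S

  Apex : Fin (n G) → Subset (n G) → Set
  Apex c T = ∀ u → u ∈ T → u ≢ c → adj G c u ≡ true

  Apex-⊆ : T ⊆ S → Apex c S → Apex c T
  Apex-⊆ T⊆S apex u u∈T = apex u (T⊆S u∈T)

  ConeClosed : (Subset (n G) → Set) → Set
  ConeClosed Q = ∀ {T} u → u ∈ T → IsCone G (T ∩ nbhd G u) →
                 Q (delete G T u) → Q (T ∩ nbhd G u) → Q T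

  cone-elim : (Q : Subset (n G) → Set) → (∀ x → Q ⁅ x ⁆) → ConeClosed Q → IsCone G T → Q T
  cone-elim {T} Q Q-singleton Q-closed (c , c∈T , apex) = go (⊂-wellFounded T) c∈T apex
    where
    go : ∀ {T} → Acc _⊂_ T → c ∈ T → Apex c T → Q T
    go {T} (acc smaller) c∈T apex with any? (λ u → (u ∈? T) ×-dec ¬? (u ≟ c))
    ... | no onlyApex = subst Q (⊆-antisym ⁅c⁆⊆T T⊆⁅c⁆) (Q-singleton c)
      where
      T⊆⁅c⁆ : T ⊆ ⁅ c ⁆
      T⊆⁅c⁆ {u} u∈T = Equivalence.from x∈⁅y⁆⇔x≡y
        (decidable-stable (u ≟ c) (λ u≢c → onlyApex (u , u∈T , u≢c)))
      ⁅c⁆⊆T : ⁅ c ⁆ ⊆ T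
      ⁅c⁆⊆T p = subst (_∈ T) (sym (x∈⁅y⁆⇒x≡y c p)) c∈T
    ... | yes (u , u∈T , u≢c) =
      Q-closed u u∈T (c , c∈N , apexN)
        (go (smaller (delete-⊂ u∈T)) (∈-delete⁺ c∈T (u≢c ∘ sym)) (Apex-⊆ (proj₁ ∘ ∈-delete⁻) apex))
        (go (smaller (nbhd-⊂ u∈T)) c∈N apexN)
      where
      c∈N : c ∈ T ∩ nbhd G u
      c∈N = ∈-nbhd⁺ c∈T (trans (adj-sym G u c) (apex u u∈T u≢c))
      apexN : Apex c (T ∩ nbhd G u)
      apexN = Apex-⊆ (proj₁ ∘ ∈-nbhd⁻) apex

  cone⇒Dism₀ : IsCone G T → Dism G 0 T
  cone⇒Dism₀ = cone-elim (Dism G 0) single (λ u u∈T cone d _ → step u u∈T cone d)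

  cone⇒Collapsible : IsCone G T → Collapsible T
  cone⇒Collapsible = cone-elim Collapsible point (λ u u∈T _ → split u u∈T)

  mutual
    Dism-suc : ∀ k → Dism G k S → Dism G (suc k) S
    Dism-suc k (single x) = single x
    Dism-suc k (step v v∈S dv d) = step v v∈S (VertexDism-suc k dv) (Dism-suc k d)

    VertexDism-suc : ∀ k → VertexDism G k S v → VertexDism G (suc k) S v
    VertexDism-suc zero = cone⇒Dism₀
    VertexDism-suc (suc k) = Dism-suc k

  Dism-mono : ∀ {k l} → k ≤ l → Dism G k S → Dism G l S
  Dism-mono = go ∘ ≤⇒≤′
    where
    go : ∀ {k l} → k ≤′ l → Dism G k S → Dism G l S
    go ≤′-refl d = d
    go (≤′-step k≤′l) d = Dism-suc _ (go k≤′l d)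

  Collapsible⇒Dism : Collapsible S → ∃ λ k → Dism G k S
  Collapsible⇒Dism (point x) = 0 , single x
  Collapsible⇒Dism (split v v∈S c₁ c₂) with Collapsible⇒Dism c₁ | Collapsible⇒Dism c₂
  ... | k₁ , d₁ | k₂ , d₂ = suc (k₁ ⊔ k₂) ,
    step v v∈S (Dism-mono (m≤n⊔m k₁ k₂) d₂) (Dism-mono (m≤n⇒m≤1+n (m≤m⊔n k₁ k₂)) d₁)

  mutual
    Dism⇒Collapsible : ∀ k → Dism G k S → Collapsible S
    Dism⇒Collapsible k (single x) = point x
    Dism⇒Collapsible k (step v v∈S dv d) = split v v∈S (Dism⇒Collapsible k d) (VertexDism⇒Collapsible k dv)

    VertexDism⇒Collapsible : ∀ k → VertexDism G k S v → Collapsible (S ∩ nbhd G v)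
    VertexDism⇒Collapsible zero = cone⇒Collapsible
    VertexDism⇒Collapsible (suc k) = Dism⇒Collapsible k

  IsImageOf-delete-zero : ∀ {f : Fin (suc m) → Fin (n G)} → Injective _≡_ _≡_ f →
                          IsImageOf S f → IsImageOf (delete G S (f zero)) (f ∘ suc)
  IsImageOf-delete-zero f-inj img .image⊆ j = ∈-delete⁺ (image⊆ img (suc j)) (0≢1+n ∘ sym ∘ f-inj)
  IsImageOf-delete-zero f-inj img .⊆image u∈D with ∈-delete⁻ u∈D
  ... | u∈S , u≢f0 with ⊆image img u∈S
  ...   | zero , refl = ⊥-elim (u≢f0 refl)
  ...   | suc j , f[1+j]≡u = j , f[1+j]≡u

  IsImageOf-nbhd-zero : {nb : Fin (n H) → Bool} (e : InducedEmbedding (addVertex H nb) G) →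
                        IsImageOf S (emb e) → (f : InducedEmbedding A H) →
                        (∀ u → nb u ≡ true → ∃ λ i → emb f i ≡ u) → (∀ i → nb (emb f i) ≡ true) →
                        IsImageOf (S ∩ nbhd G (emb e zero)) (emb e ∘ suc ∘ emb f)
  IsImageOf-nbhd-zero e img f nb⇒f f⇒nb .image⊆ i =
    ∈-nbhd⁺ (image⊆ img _) (trans (adjEmb e zero (suc (emb f i))) (f⇒nb i))
  IsImageOf-nbhd-zero e img f nb⇒f f⇒nb .⊆image u∈N with ∈-nbhd⁻ u∈N
  ... | u∈S , vu with ⊆image img u∈S
  ...   | zero , refl = ⊥-elim (adj⇒≢ vu refl)
  ...   | suc j , refl with nb⇒f j (trans (sym (adjEmb e zero (suc j))) vu)
  ...     | i , refl = i , refl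

  ISV⇒Collapsible : ISV H → (e : InducedEmbedding H G) → IsImageOf S (emb e) → Collapsible S
  ISV⇒Collapsible base e img = subst Collapsible (sym (IsImageOf-singleton img)) (point _)
  ISV⇒Collapsible (iso isv H₀≅H) e img =
    ISV⇒Collapsible isv (e ∘ᴱ ≅⇒embedding H₀≅H)
      (IsImageOf-∘ img (λ y → from y , strictlyInverseˡ y))
    where open Inverse (_≅_.bij H₀≅H)
  ISV⇒Collapsible (extend isv₀ isv′ f nb nb⇒f f⇒nb) e img =
    split (emb e zero) (image⊆ img zero)
      (ISV⇒Collapsible isv₀ (e ∘ᴱ suc-embedding nb) (IsImageOf-delete-zero (inj e) img))
      (ISV⇒Collapsible isv′ (e ∘ᴱ suc-embedding nb ∘ᴱ f) (IsImageOf-nbhd-zero e img f nb⇒f f⇒nb))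

  record Realisation (S : Subset (n G)) : Set where
    field
      {graph}   : Graph
      isv       : ISV graph
      embedding : InducedEmbedding graph G
      image     : IsImageOf S (emb embedding)

  addVertex-embedding : (e : InducedEmbedding H G) → (∀ i → emb e i ≢ v) →
                        InducedEmbedding (addVertex H (adj G v ∘ emb e)) G
  addVertex-embedding {H = H} {v = v} e ≢v = record { emb = E ; inj = E-inj ; adjEmb = E-adj }
    where
    E : Fin (suc (n H)) → Fin (n G)
    E zero = v
    E (suc i) = emb e i
    E-inj : Injective _≡_ _≡_ E
    E-inj {zero} {zero} _ = refl
    E-inj {zero} {suc j} eq = ⊥-elim (≢v j (sym eq))
    E-inj {suc i} {zero} eq = ⊥-elim (≢v i eq)
    E-inj {suc i} {suc j} eq = cong suc (inj e eq)
    E-adj : ∀ a b → adj G (E a) (E b) ≡ adj (addVertex H (adj G v ∘ emb e)) a b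
    E-adj zero zero = irrefl G v
    E-adj zero (suc j) = refl
    E-adj (suc i) zero = adj-sym G (emb e i) v
    E-adj (suc i) (suc j) = adjEmb e i j

  IsImageOf-addVertex : (e : InducedEmbedding H G) → v ∈ S → (img : IsImageOf (delete G S v) (emb e)) →
                        IsImageOf S (emb (addVertex-embedding e (proj₂ ∘ ∈-delete⁻ ∘ image⊆ img)))
  IsImageOf-addVertex e v∈S img .image⊆ zero = v∈S
  IsImageOf-addVertex e v∈S img .image⊆ (suc i) = proj₁ (∈-delete⁻ (image⊆ img i))
  IsImageOf-addVertex {v = v} e v∈S img .⊆image {u} u∈S with u ≟ v
  ... | yes refl = zero , refl
  ... | no u≢v with ⊆image img (∈-delete⁺ u∈S u≢v)
  ...   | i , eᵢ≡u = suc i , eᵢ≡u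

  Collapsible⇒Realisation : Collapsible S → Realisation S
  Collapsible⇒Realisation (point x) = record
    { isv       = base
    ; embedding = record { emb = λ _ → x ; inj = λ { {zero} {zero} _ → refl } ; adjEmb = λ _ _ → irrefl G x }
    ; image     = record { image⊆ = λ _ → x∈⁅x⁆ x ; ⊆image = λ p → zero , sym (x∈⁅y⁆⇒x≡y x p) }
    }
  Collapsible⇒Realisation {S} (split v v∈S c₁ c₂) = record
    { isv       = extend isv₁ isv₂ f nb nb⇒f f⇒nb
    ; embedding = addVertex-embedding e₁ (proj₂ ∘ ∈-delete⁻ ∘ image⊆ img₁)
    ; image     = IsImageOf-addVertex e₁ v∈S img₁
    }
    where
    open Realisation (Collapsible⇒Realisation c₁) renaming (graph to H₁; isv to isv₁; embedding to e₁; image to img₁)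
    open Realisation (Collapsible⇒Realisation c₂) renaming (graph to H₂; isv to isv₂; embedding to e₂; image to img₂)
    nb : Fin (n H₁) → Bool
    nb = adj G v ∘ emb e₁
    N⊆D : ∀ i → ∃ λ j → emb e₁ j ≡ emb e₂ i
    N⊆D i with ∈-nbhd⁻ (image⊆ img₂ i)
    ... | u∈S , vu = ⊆image img₁ (∈-delete⁺ u∈S (adj⇒≢ vu))
    factored : Σ (InducedEmbedding H₂ H₁) λ f → ∀ i → emb e₁ (emb f i) ≡ emb e₂ i
    factored = factor-embedding e₁ e₂ N⊆D
    f : InducedEmbedding H₂ H₁
    f = proj₁ factored
    commutes : ∀ i → emb e₁ (emb f i) ≡ emb e₂ i
    commutes = proj₂ factored
    nb⇒f : ∀ j → nb j ≡ true → ∃ λ i → emb f i ≡ j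
    nb⇒f j vu with ⊆image img₂ (∈-nbhd⁺ (proj₁ (∈-delete⁻ (image⊆ img₁ j))) vu)
    ... | i , eᵢ≡e₁j = i , inj e₁ (trans (commutes i) eᵢ≡e₁j)
    f⇒nb : ∀ i → nb (emb f i) ≡ true
    f⇒nb i = trans (cong (adj G v) (commutes i)) (proj₂ (∈-nbhd⁻ (image⊆ img₂ i)))

theorem5p5 : (G : Graph) → ISV G ⇔ (∃ λ (k : ℕ) → Dismantlable k G)
theorem5p5 G = mk⇔
  (λ isv → Collapsible⇒Dism G (ISV⇒Collapsible G isv id-embedding IsImageOf-⊤-id))
  (λ (k , d) → fromRealisation (Collapsible⇒Realisation G (Dism⇒Collapsible G k d)))
  where
  fromRealisation : Realisation G ⊤ → ISV G
  fromRealisation R = iso isv (onto-embedding⇒≅ embedding image)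
    where open Realisation R
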